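{- Consider the six identities \begin{itemize} \item[$(\cdot\wedge)$] $x (y\wedge z) = x y\wedge x z$, \item[$(\wedge\cdot)$] $(x\wedge y) z = x z\wedge y z$, \item[$(\backslash\vee)$] $x\backslash (y\vee z) = x\backslash y\vee x\backslash z$, \item[$(\vee\slash)$] $(x\vee y)\slash z = x\slash z\vee y\slash z$, \item[$(\wedge\backslash)$] $(x\wedge y)\backslash z = x\backslash z\vee y\backslash z$, \item[$(\slash\wedge)$] $x\slash (y\wedge z) = x\slash y\vee x\slash z$, \end{itemize} and pair each with two "antecedents" as follows: $(\backslash\vee)$ with $\{(\vee\slash),(\wedge\backslash)\}$; $(\vee\slash)$ with $\{(\backslash\vee),(\slash\wedge)\}$; $(\slash\wedge)$ with $\{(\cdot\wedge),(\vee\slash)\}$; $(\wedge\backslash)$ with $\{(\wedge\cdot),(\backslash\vee)\}$; $(\wedge\cdot)$ with $\{(\wedge\backslash),(\cdot\wedge)\}$; $(\cdot\wedge)$ with $\{(\slash\wedge),(\wedge\cdot)\}$. (Over residuated binars with distributive lattice reducts, each identity is implied by its two antecedents.) Then these are the only implications among the six identities: for every subset $\Sigma$ of the six identities and every one of the six identities $\epsilon\notin\Sigma$ such that $\Sigma$ does not contain both antecedents of $\epsilon$, the identities in $\Sigma$ do not jointly entail $\epsilon$ over the class of residuated binars with distributive lattice reducts. The same holds over the class of residuated semigroups (associative residuated binars) with distributive lattice reducts.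
   Context: A residuated binar is an algebra $\mathbf A=(A,\wedge,\vee,\cdot,\backslash,\slash)$ where $(A,\wedge,\vee)$ is a lattice, $\cdot$ is a binary operation on $A$ (written $xy$), and for all $x,y,z\in A$: $x\cdot y\le z \iff x\le z\slash y \iff y\le x\backslash z$. A residuated semigroup is a residuated binar in which $\cdot$ is associative. Convention: $\cdot$ binds more tightly than $\backslash,\slash$, which bind more tightly than $\wedge,\vee$. A set $\Sigma$ of identities entails $\epsilon$ over a class $K$ if every member of $K$ satisfying all identities of $\Sigma$ satisfies $\epsilon$. -}

module Defs where

open import Level using (0ℓ)
open import Data.Bool using (Bool; true; false)
open import Data.Product using (_×_; Σ)
open import Relation.Binary.PropositionalEquality using (_≡_)
open import Relation.Nullary using (¬_)
open import Function.Bundles using (_⇔_)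
open import Algebra.Core using (Op₂)
import Algebra.Definitions as AD
open import Algebra.Lattice.Bundles using (Lattice)

record ResiduatedBinar : Set₁ where
  infixl 8 _·_
  infixr 7 _⧵_
  infixl 7 _⧸_
  field
    lattice : Lattice 0ℓ 0ℓ
  open Lattice lattice public
  infix 4 _≤_
  _≤_ : Carrier → Carrier → Set
  x ≤ y = (x ∧ y) ≈ x
  field
    _·_ : Op₂ Carrier
    _⧵_ : Op₂ Carrier
    _⧸_ : Op₂ Carrier
    ·-cong : AD.Congruent₂ _≈_ _·_
    ⧵-cong : AD.Congruent₂ _≈_ _⧵_
    ⧸-cong : AD.Congruent₂ _≈_ _⧸_
    residuation-right : ∀ x y z → (x · y ≤ z) ⇔ (x ≤ z ⧸ y)
    residuation-left  : ∀ x y z → (x · y ≤ z) ⇔ (y ≤ x ⧵ z)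

DistributiveReduct : ResiduatedBinar → Set
DistributiveReduct A = AD._DistributesOver_ _≈_ _∧_ _∨_
  where open ResiduatedBinar A

IsAssociative : ResiduatedBinar → Set
IsAssociative A = AD.Associative _≈_ _·_
  where open ResiduatedBinar A

data Identity : Set where
  ·∧ ∧· ⧵∨ ∨⧸ ∧⧵ ⧸∧ : Identity

Holds : ResiduatedBinar → Identity → Set
Holds A ·∧ = ∀ x y z → x · (y ∧ z) ≈ x · y ∧ x · z
  where open ResiduatedBinar A
Holds A ∧· = ∀ x y z → (x ∧ y) · z ≈ x · z ∧ y · z
  where open ResiduatedBinar A
Holds A ⧵∨ = ∀ x y z → x ⧵ (y ∨ z) ≈ x ⧵ y ∨ x ⧵ z
  where open ResiduatedBinar A
Holds A ∨⧸ = ∀ x y z → (x ∨ y) ⧸ z ≈ x ⧸ z ∨ y ⧸ z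
  where open ResiduatedBinar A
Holds A ∧⧵ = ∀ x y z → (x ∧ y) ⧵ z ≈ x ⧵ z ∨ y ⧵ z
  where open ResiduatedBinar A
Holds A ⧸∧ = ∀ x y z → x ⧸ (y ∧ z) ≈ x ⧸ y ∨ x ⧸ z
  where open ResiduatedBinar A

antecedent₁ antecedent₂ : Identity → Identity
antecedent₁ ⧵∨ = ∨⧸
antecedent₁ ∨⧸ = ⧵∨
antecedent₁ ⧸∧ = ·∧
antecedent₁ ∧⧵ = ∧·
antecedent₁ ∧· = ∧⧵
antecedent₁ ·∧ = ⧸∧
antecedent₂ ⧵∨ = ∧⧵
antecedent₂ ∨⧸ = ⧸∧
antecedent₂ ⧸∧ = ∨⧸
antecedent₂ ∧⧵ = ⧵∨
antecedent₂ ∧· = ·∧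
antecedent₂ ·∧ = ∧·

Subset6 : Set
Subset6 = Identity → Bool

Satisfies : ResiduatedBinar → Subset6 → Set
Satisfies A S = ∀ i → S i ≡ true → Holds A i

NotEntailedDRB : Subset6 → Identity → Set₁
NotEntailedDRB S ε =
  Σ ResiduatedBinar λ A → DistributiveReduct A × Satisfies A S × ¬ Holds A ε

NotEntailedDRS : Subset6 → Identity → Set₁
NotEntailedDRS S ε =
  Σ ResiduatedBinar λ A →
    IsAssociative A × DistributiveReduct A × Satisfies A S × ¬ Holds A ε

-- The six identities form a hexagon  ⧵∨ — ∨⧸ — ⧸∧ — ·∧ — ∧· — ∧⧵ — ⧵∨  in which the
-- antecedents of an identity are its two neighbours.  For each of the six edges there
-- is a finite residuated semigroup with distributive lattice reduct (on four to six
-- elements) in which exactly the two endpoints of the edge fail.  If Σ misses ε and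
-- one of its neighbours, the algebra of that edge satisfies Σ but not ε.
module Submission where

open import Defs
open import Data.Bool using (true; false)
open import Data.Product using (_×_)
open import Relation.Binary.PropositionalEquality using (_≡_)
open import Relation.Nullary using (¬_)

open import Agda.Builtin.FromNat using (Number; fromNat)
open import Algebra.Core using (Op₂)
import Algebra.Definitions
open import Data.Empty using (⊥-elim)
open import Data.Fin using (Fin; zero; suc)
import Data.Fin.Literals as Fin
import Data.Fin.Properties as Fin
open import Data.List using (List; foldr; filter; allFin)
open import Data.Nat as ℕ using (ℕ)
import Data.Nat.Literals
open import Data.Product using (_,_; Σ; uncurry)
open import Data.Unit using (⊤; tt)
open import Data.Vec using (Vec; []; _∷_; lookup)
open import Function.Bundles using (_⇔_; mk⇔; Equivalence)
open import Relation.Binary.Definitions using (DecidableEquality)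
open import Relation.Binary.PropositionalEquality using (_≢_; refl; sym; trans; cong; cong₂; subst; isEquivalence)
open import Relation.Nullary using (Dec; ¬?; _×-dec_; _→-dec_; contradiction)
open import Relation.Nullary.Decidable using (True; toWitness; map′)

instance
  ℕ-number : Number ℕ
  ℕ-number = Data.Nat.Literals.number
  Fin-number : ∀ {n} → Number (Fin n)
  Fin-number = Fin.number _
  -- the side conditions of numeric literals compute to ⊤
  trivial : ⊤
  trivial = tt

_⇔-dec_ : ∀ {A B : Set} → Dec A → Dec B → Dec (A ⇔ B)
a? ⇔-dec b? = map′ (uncurry mk⇔) (λ e → Equivalence.to e , Equivalence.from e)
                   ((a? →-dec b?) ×-dec (b? →-dec a?))

∀₃? : ∀ {n} {P : Fin n → Fin n → Fin n → Set} →
      (∀ x y z → Dec (P x y z)) → Dec (∀ x y z → P x y z)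
∀₃? P? = Fin.all? λ x → Fin.all? λ y → Fin.all? λ z → P? x y z

∀₂? : ∀ {n} {P : Fin n → Fin n → Set} →
      (∀ x y → Dec (P x y)) → Dec (∀ x y → P x y)
∀₂? P? = Fin.all? λ x → Fin.all? λ y → P? x y

toFin : Identity → Fin 6
toFin ·∧ = 0
toFin ∧· = 1
toFin ⧵∨ = 2
toFin ∨⧸ = 3
toFin ∧⧵ = 4
toFin ⧸∧ = 5

fromFin : Fin 6 → Identity
fromFin zero = ·∧
fromFin (suc zero) = ∧·
fromFin (suc (suc zero)) = ⧵∨
fromFin (suc (suc (suc zero))) = ∨⧸
fromFin (suc (suc (suc (suc zero)))) = ∧⧵
fromFin (suc (suc (suc (suc (suc zero))))) = ⧸∧

fromFin-toFin : ∀ i → fromFin (toFin i) ≡ i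
fromFin-toFin ·∧ = refl
fromFin-toFin ∧· = refl
fromFin-toFin ⧵∨ = refl
fromFin-toFin ∨⧸ = refl
fromFin-toFin ∧⧵ = refl
fromFin-toFin ⧸∧ = refl

toFin-injective : ∀ {i j} → toFin i ≡ toFin j → i ≡ j
toFin-injective {i} {j} eq = trans (sym (fromFin-toFin i)) (trans (cong fromFin eq) (fromFin-toFin j))

_≟_ : DecidableEquality Identity
i ≟ j = map′ toFin-injective (cong toFin) (toFin i Fin.≟ toFin j)

all-identities? : {P : Identity → Set} → (∀ i → Dec (P i)) → Dec (∀ i → P i)
all-identities? {P} P? =
  map′ (λ ∀P i → subst P (fromFin-toFin i) (∀P (toFin i))) (λ ∀P k → ∀P (fromFin k))
       (Fin.all? λ k → P? (fromFin k))

Separates : ResiduatedBinar → Identity → Identity → Set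
Separates A ε δ =
  DistributiveReduct A × IsAssociative A ×
  ¬ Holds A ε × ¬ Holds A δ × (∀ i → i ≢ ε → i ≢ δ → Holds A i)

Separator : Identity → Identity → Set₁
Separator ε δ = Σ ResiduatedBinar λ A → Separates A ε δ

separator-sym : ∀ {ε δ} → Separator ε δ → Separator δ ε
separator-sym (A , dist , assoc , ¬ε , ¬δ , others) =
  A , dist , assoc , ¬δ , ¬ε , λ i i≢δ i≢ε → others i i≢ε i≢δ

∈-∉-≢ : ∀ {S : Subset6} {i j} → S i ≡ true → S j ≡ false → i ≢ j
∈-∉-≢ Si Sj refl = contradiction (trans (sym Si) Sj) λ ()

separator⇒notEntailed : ∀ {ε δ} (S : Subset6) → Separator ε δ → S ε ≡ false → S δ ≡ false →
                        NotEntailedDRB S ε × NotEntailedDRS S ε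
separator⇒notEntailed S (A , dist , assoc , ¬ε , _ , others) Sε Sδ =
  (A , dist , satisfies , ¬ε) , (A , assoc , dist , satisfies , ¬ε)
  where
  satisfies : Satisfies A S
  satisfies i Si = others i (∈-∉-≢ {S} Si Sε) (∈-∉-≢ {S} Si Sδ)

Table : ℕ → Set
Table n = Vec (Vec (Fin n) n) n

record LatticeTables (n : ℕ) : Set where
  field
    meet join : Table n

module FiniteBinar {n : ℕ} (L : LatticeTables (ℕ.suc n)) (mul : Table (ℕ.suc n)) where
  private
    C = Fin (ℕ.suc n)
  open Algebra.Definitions (_≡_ {A = C})

  infixl 8 _·_
  infixr 7 _⧵_
  infixl 7 _⧸_
  infixr 6 _∧_
  infixr 5 _∨_
  infix 4 _≤_ _≤?_

  _∧_ _∨_ _·_ _⧵_ _⧸_ : Op₂ C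
  x ∧ y = lookup (lookup (LatticeTables.meet L) x) y
  x ∨ y = lookup (lookup (LatticeTables.join L) x) y
  x · y = lookup (lookup mul x) y

  _≤_ : C → C → Set
  x ≤ y = x ∧ y ≡ x

  _≤?_ : ∀ x y → Dec (x ≤ y)
  x ≤? y = x ∧ y Fin.≟ x

  ⋁ : List C → C
  ⋁ = foldr _∨_ zero

  -- x ⧵ z = ⋁ {y ∣ x · y ≤ z} is the residual only if 0 is the bottom and · preserves
  -- joins; residuated? below checks that the result is indeed residuated.
  x ⧵ z = ⋁ (filter (λ y → x · y ≤? z) (allFin _))
  z ⧸ x = ⋁ (filter (λ y → y · x ≤? z) (allFin _))

  LatticeLaws : Set
  LatticeLaws = Commutative _∨_ × Associative _∨_ × Commutative _∧_ × Associative _∧_ ×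
                Absorptive _∨_ _∧_

  latticeLaws? : Dec LatticeLaws
  latticeLaws? =
    ∀₂? (λ x y → x ∨ y Fin.≟ y ∨ x) ×-dec ∀₃? (λ x y z → (x ∨ y) ∨ z Fin.≟ x ∨ (y ∨ z)) ×-dec
    ∀₂? (λ x y → x ∧ y Fin.≟ y ∧ x) ×-dec ∀₃? (λ x y z → (x ∧ y) ∧ z Fin.≟ x ∧ (y ∧ z)) ×-dec
    ∀₂? (λ x y → x ∨ (x ∧ y) Fin.≟ x) ×-dec ∀₂? (λ x y → x ∧ (x ∨ y) Fin.≟ x)

  Residuated : Set
  Residuated = (∀ x y z → (x · y ≤ z) ⇔ (x ≤ z ⧸ y)) × (∀ x y z → (x · y ≤ z) ⇔ (y ≤ x ⧵ z))

  residuated? : Dec Residuated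
  residuated? = ∀₃? (λ x y z → (x · y ≤? z) ⇔-dec (x ≤? z ⧸ y)) ×-dec
                ∀₃? (λ x y z → (x · y ≤? z) ⇔-dec (y ≤? x ⧵ z))

  binar : LatticeLaws → Residuated → ResiduatedBinar
  binar (∨-comm , ∨-assoc , ∧-comm , ∧-assoc , absorptive) (residuation-right , residuation-left) =
    record
      { lattice = record
        { Carrier = C ; _≈_ = _≡_ ; _∨_ = _∨_ ; _∧_ = _∧_
        ; isLattice = record
          { isEquivalence = isEquivalence
          ; ∨-comm = ∨-comm ; ∨-assoc = ∨-assoc ; ∨-cong = cong₂ _∨_
          ; ∧-comm = ∧-comm ; ∧-assoc = ∧-assoc ; ∧-cong = cong₂ _∧_
          ; absorptive = absorptive } }
      ; _·_ = _·_ ; _⧵_ = _⧵_ ; _⧸_ = _⧸_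
      ; ·-cong = cong₂ _·_ ; ⧵-cong = cong₂ _⧵_ ; ⧸-cong = cong₂ _⧸_
      ; residuation-right = residuation-right
      ; residuation-left = residuation-left }

  module _ {laws : LatticeLaws} {residuated : Residuated} where
    private
      A = binar laws residuated

    distributive? : Dec (DistributiveReduct A)
    distributive? = ∀₃? (λ x y z → x ∧ (y ∨ z) Fin.≟ x ∧ y ∨ x ∧ z) ×-dec
                    ∀₃? (λ x y z → (y ∨ z) ∧ x Fin.≟ y ∧ x ∨ z ∧ x)

    associative? : Dec (IsAssociative A)
    associative? = ∀₃? λ x y z → (x · y) · z Fin.≟ x · (y · z)

    holds? : ∀ i → Dec (Holds A i)
    holds? ·∧ = ∀₃? λ x y z → x · (y ∧ z) Fin.≟ x · y ∧ x · z
    holds? ∧· = ∀₃? λ x y z → (x ∧ y) · z Fin.≟ x · z ∧ y · z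
    holds? ⧵∨ = ∀₃? λ x y z → x ⧵ (y ∨ z) Fin.≟ x ⧵ y ∨ x ⧵ z
    holds? ∨⧸ = ∀₃? λ x y z → (x ∨ y) ⧸ z Fin.≟ x ⧸ z ∨ y ⧸ z
    holds? ∧⧵ = ∀₃? λ x y z → (x ∧ y) ⧵ z Fin.≟ x ⧵ z ∨ y ⧵ z
    holds? ⧸∧ = ∀₃? λ x y z → x ⧸ (y ∧ z) Fin.≟ x ⧸ y ∨ x ⧸ z

    separates? : ∀ ε δ → Dec (Separates A ε δ)
    separates? ε δ =
      distributive? ×-dec associative? ×-dec ¬? (holds? ε) ×-dec ¬? (holds? δ) ×-dec
      all-identities? (λ i → ¬? (i ≟ ε) →-dec ¬? (i ≟ δ) →-dec holds? i)

  separator : ∀ {ε δ} {laws : True latticeLaws?} {res : True residuated?} →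
              {separates : True (separates? {toWitness laws} {toWitness res} ε δ)} →
              Separator ε δ
  separator {separates = separates} = binar _ _ , toWitness separates

square : LatticeTables 4
square = record
  { meet =
      (0 ∷ 0 ∷ 0 ∷ 0 ∷ []) ∷
      (0 ∷ 1 ∷ 0 ∷ 1 ∷ []) ∷
      (0 ∷ 0 ∷ 2 ∷ 2 ∷ []) ∷
      (0 ∷ 1 ∷ 2 ∷ 3 ∷ []) ∷
      []
  ; join =
      (0 ∷ 1 ∷ 2 ∷ 3 ∷ []) ∷
      (1 ∷ 1 ∷ 3 ∷ 3 ∷ []) ∷
      (2 ∷ 3 ∷ 2 ∷ 3 ∷ []) ∷
      (3 ∷ 3 ∷ 3 ∷ 3 ∷ []) ∷
      []
  }

square⊕⊤ : LatticeTables 5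
square⊕⊤ = record
  { meet =
      (0 ∷ 0 ∷ 0 ∷ 0 ∷ 0 ∷ []) ∷
      (0 ∷ 1 ∷ 0 ∷ 1 ∷ 1 ∷ []) ∷
      (0 ∷ 0 ∷ 2 ∷ 2 ∷ 2 ∷ []) ∷
      (0 ∷ 1 ∷ 2 ∷ 3 ∷ 3 ∷ []) ∷
      (0 ∷ 1 ∷ 2 ∷ 3 ∷ 4 ∷ []) ∷
      []
  ; join =
      (0 ∷ 1 ∷ 2 ∷ 3 ∷ 4 ∷ []) ∷
      (1 ∷ 1 ∷ 3 ∷ 3 ∷ 4 ∷ []) ∷
      (2 ∷ 3 ∷ 2 ∷ 3 ∷ 4 ∷ []) ∷
      (3 ∷ 3 ∷ 3 ∷ 3 ∷ 4 ∷ []) ∷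
      (4 ∷ 4 ∷ 4 ∷ 4 ∷ 4 ∷ []) ∷
      []
  }

-- (i , j) ∈ 3 × 2 is encoded as i + 3 j
chain₃×chain₂ : LatticeTables 6
chain₃×chain₂ = record
  { meet =
      (0 ∷ 0 ∷ 0 ∷ 0 ∷ 0 ∷ 0 ∷ []) ∷
      (0 ∷ 1 ∷ 1 ∷ 0 ∷ 1 ∷ 1 ∷ []) ∷
      (0 ∷ 1 ∷ 2 ∷ 0 ∷ 1 ∷ 2 ∷ []) ∷
      (0 ∷ 0 ∷ 0 ∷ 3 ∷ 3 ∷ 3 ∷ []) ∷
      (0 ∷ 1 ∷ 1 ∷ 3 ∷ 4 ∷ 4 ∷ []) ∷
      (0 ∷ 1 ∷ 2 ∷ 3 ∷ 4 ∷ 5 ∷ []) ∷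
      []
  ; join =
      (0 ∷ 1 ∷ 2 ∷ 3 ∷ 4 ∷ 5 ∷ []) ∷
      (1 ∷ 1 ∷ 2 ∷ 4 ∷ 4 ∷ 5 ∷ []) ∷
      (2 ∷ 2 ∷ 2 ∷ 5 ∷ 5 ∷ 5 ∷ []) ∷
      (3 ∷ 4 ∷ 5 ∷ 3 ∷ 4 ∷ 5 ∷ []) ∷
      (4 ∷ 4 ∷ 5 ∷ 4 ∷ 4 ∷ 5 ∷ []) ∷
      (5 ∷ 5 ∷ 5 ∷ 5 ∷ 5 ∷ 5 ∷ []) ∷
      []
  }

separator-⧵∨-∨⧸ : Separator ⧵∨ ∨⧸
separator-⧵∨-∨⧸ = FiniteBinar.separator square mul
  where
  mul : Table 4
  mul = (0 ∷ 0 ∷ 0 ∷ 0 ∷ []) ∷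
        (0 ∷ 3 ∷ 0 ∷ 3 ∷ []) ∷
        (0 ∷ 0 ∷ 0 ∷ 0 ∷ []) ∷
        (0 ∷ 3 ∷ 0 ∷ 3 ∷ []) ∷
        []

separator-⧵∨-∧⧵ : Separator ⧵∨ ∧⧵
separator-⧵∨-∧⧵ = FiniteBinar.separator square mul
  where
  mul : Table 4
  mul = (0 ∷ 0 ∷ 0 ∷ 0 ∷ []) ∷
        (0 ∷ 1 ∷ 0 ∷ 1 ∷ []) ∷
        (0 ∷ 2 ∷ 0 ∷ 2 ∷ []) ∷
        (0 ∷ 3 ∷ 0 ∷ 3 ∷ []) ∷
        []

separator-∨⧸-⧸∧ : Separator ∨⧸ ⧸∧
separator-∨⧸-⧸∧ = FiniteBinar.separator square mul
  where
  mul : Table 4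
  mul = (0 ∷ 0 ∷ 0 ∷ 0 ∷ []) ∷
        (0 ∷ 1 ∷ 2 ∷ 3 ∷ []) ∷
        (0 ∷ 0 ∷ 0 ∷ 0 ∷ []) ∷
        (0 ∷ 1 ∷ 2 ∷ 3 ∷ []) ∷
        []

separator-·∧-⧸∧ : Separator ·∧ ⧸∧
separator-·∧-⧸∧ = FiniteBinar.separator square⊕⊤ mul
  where
  mul : Table 5
  mul = (0 ∷ 0 ∷ 0 ∷ 0 ∷ 0 ∷ []) ∷
        (0 ∷ 0 ∷ 0 ∷ 0 ∷ 0 ∷ []) ∷
        (0 ∷ 1 ∷ 4 ∷ 4 ∷ 4 ∷ []) ∷
        (0 ∷ 1 ∷ 4 ∷ 4 ∷ 4 ∷ []) ∷
        (0 ∷ 1 ∷ 4 ∷ 4 ∷ 4 ∷ []) ∷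
        []

separator-∧·-∧⧵ : Separator ∧· ∧⧵
separator-∧·-∧⧵ = FiniteBinar.separator square⊕⊤ mul
  where
  mul : Table 5
  mul = (0 ∷ 0 ∷ 0 ∷ 0 ∷ 0 ∷ []) ∷
        (0 ∷ 0 ∷ 1 ∷ 1 ∷ 1 ∷ []) ∷
        (0 ∷ 0 ∷ 4 ∷ 4 ∷ 4 ∷ []) ∷
        (0 ∷ 0 ∷ 4 ∷ 4 ∷ 4 ∷ []) ∷
        (0 ∷ 0 ∷ 4 ∷ 4 ∷ 4 ∷ []) ∷
        []

separator-·∧-∧· : Separator ·∧ ∧·
separator-·∧-∧· = FiniteBinar.separator chain₃×chain₂ mul
  where
  mul : Table 6
  mul = (0 ∷ 0 ∷ 0 ∷ 0 ∷ 0 ∷ 0 ∷ []) ∷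
        (0 ∷ 0 ∷ 0 ∷ 0 ∷ 0 ∷ 0 ∷ []) ∷
        (0 ∷ 0 ∷ 0 ∷ 1 ∷ 1 ∷ 1 ∷ []) ∷
        (0 ∷ 0 ∷ 1 ∷ 0 ∷ 0 ∷ 1 ∷ []) ∷
        (0 ∷ 0 ∷ 1 ∷ 0 ∷ 0 ∷ 1 ∷ []) ∷
        (0 ∷ 0 ∷ 1 ∷ 1 ∷ 1 ∷ 1 ∷ []) ∷
        []

separator₁ : ∀ ε → Separator ε (antecedent₁ ε)
separator₁ ⧵∨ = separator-⧵∨-∨⧸
separator₁ ∨⧸ = separator-sym separator-⧵∨-∨⧸
separator₁ ⧸∧ = separator-sym separator-·∧-⧸∧
separator₁ ∧⧵ = separator-sym separator-∧·-∧⧵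
separator₁ ∧· = separator-∧·-∧⧵
separator₁ ·∧ = separator-·∧-⧸∧

separator₂ : ∀ ε → Separator ε (antecedent₂ ε)
separator₂ ⧵∨ = separator-⧵∨-∧⧵
separator₂ ∨⧸ = separator-∨⧸-⧸∧
separator₂ ⧸∧ = separator-sym separator-∨⧸-⧸∧
separator₂ ∧⧵ = separator-sym separator-⧵∨-∧⧵
separator₂ ∧· = separator-sym separator-·∧-∧·
separator₂ ·∧ = separator-·∧-∧·

proposition3p1 : (S : Subset6) (ε : Identity) → S ε ≡ false →
    ¬ (S (antecedent₁ ε) ≡ true × S (antecedent₂ ε) ≡ true) →
    NotEntailedDRB S ε × NotEntailedDRS S ε
proposition3p1 S ε Sε ¬both with S (antecedent₁ ε) in S₁ | S (antecedent₂ ε) in S₂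
... | false | _     = separator⇒notEntailed S (separator₁ ε) Sε S₁
... | true  | false = separator⇒notEntailed S (separator₂ ε) Sε S₂
... | true  | true  = ⊥-elim (¬both (refl , refl))
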